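{- Let $Q=(M,\Omega)$ be a $3$-sheltering matroid. The following are equivalent: (1) $Q$ is strictly binary (that is, $M$ is representable over $GF(2)$ and $r(M)\le|\Omega|$) and each $\omega\in\Omega$ is an element of the cycle space of $M$; (2) $M$ is isomorphic to some isotropic matroid $M[IAS(G)]$ via an isomorphism that maps the classes of $\Omega$ onto the vertex triples of $G$.
   Context: A sheltering matroid is a pair $Q=(M,\Omega)$ where $M$ is a matroid on a finite set $U$ and $\Omega$ a partition of $U$ such that for any subset $I$ independent in $M$ with $|I\cap\omega|\le1$ for all $\omega\in\Omega$, and any two distinct elements $x,y$ of a class $\omega$ with $\omega\cap I=\emptyset$, $I\cup\{x\}$ or $I\cup\{y\}$ is independent in $M$. It is a $3$-sheltering matroid if every class of $\Omega$ has exactly $3$ elements. The cycle space of a binary matroid is the set of disjoint unions of its circuits (equivalently, the subsets whose representing columns sum to $0$). For a looped simple graph $G$ (finite, loops allowed, no multiple edges), $A(G)$ is its adjacency matrix over $GF(2)$ with diagonal entry $1$ exactly at looped vertices, $IAS(G)=(I\;A(G)\;A(G)+I)$ with the $v$ columns labeled $\phi_G(v),\chi_G(v),\psi_G(v)$, the isotropic matroid $M[IAS(G)]$ is the binary matroid represented by $IAS(G)$ on these labels, and the vertex triple of $v$ is $\{\phi_G(v),\chi_G(v),\psi_G(v)\}$. -}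

module Defs where

open import Data.Bool using (Bool; true; false; _∧_; _∨_; not; _xor_; if_then_else_)
open import Data.Nat using (ℕ; zero; suc; _+_; _*_; _≤_; _<_)
open import Data.Fin using (Fin; zero; suc; remQuot; _≟_)
open import Data.Product using (Σ; ∃; _×_; _,_; proj₁; proj₂)
open import Data.Sum using (_⊎_)
open import Data.List using (List)
open import Data.List.Relation.Unary.All using (All)
open import Data.List.Relation.Unary.Any using (Any)
open import Data.List.Relation.Unary.AllPairs using (AllPairs)
open import Relation.Binary.PropositionalEquality using (_≡_; _≢_)
open import Relation.Nullary using (¬_; does)
open import Function.Bundles using (_⇔_; _↔_; Inverse)

SubsetF : ℕ → Set
SubsetF n = Fin n → Bool

∅F : ∀ {n} → SubsetF n
∅F _ = false

⁅_⁆F : ∀ {n} → Fin n → SubsetF n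
⁅ x ⁆F y = does (y ≟ x)

_∪F_ : ∀ {n} → SubsetF n → SubsetF n → SubsetF n
(S ∪F T) x = S x ∨ T x

_∩F_ : ∀ {n} → SubsetF n → SubsetF n → SubsetF n
(S ∩F T) x = S x ∧ T x

_⊆F_ : ∀ {n} → SubsetF n → SubsetF n → Set
S ⊆F T = ∀ x → S x ≡ true → T x ≡ true

DisjointF : ∀ {n} → SubsetF n → SubsetF n → Set
DisjointF S T = ∀ x → S x ≡ true → T x ≡ false

∣_∣F : ∀ {n} → SubsetF n → ℕ
∣_∣F {zero} S = 0
∣_∣F {suc n} S = (if S zero then 1 else 0) + ∣ (λ i → S (suc i)) ∣F

record Matroid (n : ℕ) : Set₁ where
  field
    Indep     : SubsetF n → Set
    indep-∅   : Indep ∅F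
    indep-⊆   : ∀ A B → A ⊆F B → Indep B → Indep A
    indep-aug : ∀ A B → Indep A → Indep B → ∣ A ∣F < ∣ B ∣F →
                ∃ λ x → B x ≡ true × A x ≡ false × Indep (A ∪F ⁅ x ⁆F)

open Matroid public

RankAtMost : ∀ {n} → Matroid n → ℕ → Set
RankAtMost M k = ∀ S → Indep M S → ∣ S ∣F ≤ k

IsCircuit : ∀ {n} → Matroid n → SubsetF n → Set
IsCircuit M C = ¬ Indep M C ×
  (∀ D → D ⊆F C → (∃ λ x → C x ≡ true × D x ≡ false) → Indep M D)

InCycleSpace : ∀ {n} → Matroid n → SubsetF n → Set
InCycleSpace M X = Σ (List (SubsetF _)) λ Cs →
  All (IsCircuit M) Cs × AllPairs DisjointF Cs ×
  (∀ x → X x ≡ true ⇔ Any (λ C → C x ≡ true) Cs)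

-- Matrices over GF(2) (Bool with xor as addition)

Matrix : ℕ → ℕ → Set
Matrix m n = Fin m → Fin n → Bool

sumGF2 : ∀ {n} → (Fin n → Bool) → Bool
sumGF2 {zero} f = false
sumGF2 {suc n} f = f zero xor sumGF2 (λ i → f (suc i))

colSum : ∀ {m n} → Matrix m n → SubsetF n → Fin m → Bool
colSum A T r = sumGF2 (λ i → T i ∧ A r i)

LinIndepCols : ∀ {m n} → Matrix m n → SubsetF n → Set
LinIndepCols A S = ∀ T → T ⊆F S → (∀ r → colSum A T r ≡ false) → ∀ i → T i ≡ false

RepresentedBy : ∀ {m n} → Matroid n → Matrix m n → Set
RepresentedBy M A = ∀ S → Indep M S ⇔ LinIndepCols A S

IsBinary : ∀ {n} → Matroid n → Set
IsBinary {n} M = Σ ℕ λ m → Σ (Matrix m n) λ A → RepresentedBy M A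

-- Partitions into k classes, given by the class map cls : Fin n → Fin k

classOf : ∀ {n k} → (Fin n → Fin k) → Fin k → SubsetF n
classOf cls j x = does (cls x ≟ j)

AllClassesSize3 : ∀ {n k} → (Fin n → Fin k) → Set
AllClassesSize3 {k = k} cls = ∀ (j : Fin k) → ∣ classOf cls j ∣F ≡ 3

IsSheltering : ∀ {n k} → Matroid n → (Fin n → Fin k) → Set
IsSheltering {n} {k} M cls =
  ∀ (I : SubsetF n) → Indep M I →
  (∀ j → ∣ I ∩F classOf cls j ∣F ≤ 1) →
  ∀ (j : Fin k) (x y : Fin n) → cls x ≡ j → cls y ≡ j → x ≢ y →
  (∀ z → cls z ≡ j → I z ≡ false) →
  Indep M (I ∪F ⁅ x ⁆F) ⊎ Indep M (I ∪F ⁅ y ⁆F)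

-- 3-sheltering matroid (M, Ω) with Ω given by cls, |Ω| = k
Is3Sheltering : ∀ {n k} → Matroid n → (Fin n → Fin k) → Set
Is3Sheltering M cls = AllClassesSize3 cls × IsSheltering M cls

StrictlyBinary : ∀ {n} → Matroid n → ℕ → Set
StrictlyBinary M k = IsBinary M × RankAtMost M k

-- Looped simple graphs on vertex set Fin p: symmetric Boolean adjacency
-- matrix, diagonal entry true exactly at looped vertices.

record LoopedSimpleGraph (p : ℕ) : Set where
  field
    adj     : Fin p → Fin p → Bool
    adj-sym : ∀ u v → adj u v ≡ adj v u

open LoopedSimpleGraph public

-- Labels: Fin (p * 3); label l corresponds to (v , t) = remQuot 3 l,
-- t = 0 ↦ φ_G(v), t = 1 ↦ χ_G(v), t = 2 ↦ ψ_G(v).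
vertexOf : ∀ {p} → Fin (p * 3) → Fin p
vertexOf l = proj₁ (remQuot 3 l)

-- the matrix IAS(G) = (I  A(G)  A(G)+I), columns labelled as above
IAS : ∀ {p} → LoopedSimpleGraph p → Matrix p (p * 3)
IAS G r l with remQuot 3 l
... | v , zero = does (r ≟ v)
... | v , suc zero = adj G r v
... | v , suc (suc zero) = adj G r v xor does (r ≟ v)

IsoToIsotropic : ∀ {n k p} → Matroid n → (Fin n → Fin k) →
                 LoopedSimpleGraph p → Fin n ↔ Fin (p * 3) → Set
IsoToIsotropic {n} {k} {p} M cls G f =
  (∀ (S : SubsetF n) → Indep M S ⇔ LinIndepCols (IAS G) (λ l → S (Inverse.from f l))) ×
  (∀ (j : Fin k) → ∃ λ v → ∀ x → cls x ≡ j ⇔ vertexOf {p} (Inverse.to f x) ≡ v)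

module Submission where

-- Transport IAS(G) along the isomorphism.
-- Its φ-columns are unit vectors, so the φ-elements form an independent
-- transversal Φ of the classes spanning every column; hence no independent
-- set is larger than |Φ| = |Ω|.  The columns of a vertex triple sum to zero
-- (ψ = φ + χ), and in a binary matroid every zero-sum set is a disjoint
-- union of circuits.
--
-- Sheltering yields an independent
-- transversal B, a basis by the rank bound; label each class (φ, χ, ψ)
-- with φ ∈ B.  The expansion of χ_v in the basis defines the adjacency
-- of G, and since each class is a cycle, ψ_v = φ_v + χ_v.  So A factors as
-- A_B · N with N the relabelled IAS(G), and N represents M.  A second use of
-- sheltering shows that the adjacency is symmetric.

open import Defs
open import Algebra.Bundles using (CommutativeRing)
import Algebra.Properties.CommutativeMonoid.Sum as CommutativeMonoidSum
import Algebra.Properties.Semiring.Sum as SemiringSum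
open import Data.Bool using (Bool; true; false; _∧_; _∨_; not; _xor_; if_then_else_)
import Data.Bool.Properties as BP
open import Data.Empty using (⊥; ⊥-elim)
open import Data.Fin using (Fin; zero; suc; _≟_; toℕ; fromℕ<; combine; remQuot; quotRem; _↑ˡ_; _↑ʳ_)
import Data.Fin.Properties as FinP
open import Data.Fin.Properties
  using (all?; any?; toℕ-fromℕ<; toℕ-injective; toℕ<n; remQuot-combine; combine-remQuot)
open import Data.Fin.Subset.Properties using (anySubset?)
open import Data.List using (List; []; _∷_)
open import Data.List.Relation.Unary.All as All using (All; []; _∷_)
open import Data.List.Relation.Unary.Any using (Any; here; there)
open import Data.List.Relation.Unary.AllPairs using (AllPairs; []; _∷_)
open import Data.Nat using (ℕ; zero; suc; _+_; _*_; _≤_; _<_; z≤n; s≤s; _≤?_; _<?_)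
import Data.Nat.Properties as ℕP
open import Data.Product using (Σ; ∃; _×_; _,_; proj₁; proj₂)
open import Data.Sum using (_⊎_; inj₁; inj₂)
open import Data.Vec using (lookup; tabulate)
open import Data.Vec.Properties using (lookup∘tabulate)
open import Function.Bundles using (_⇔_; _↔_; Inverse; mk⇔; Equivalence; mk↔ₛ′)
import Function.Properties.Equivalence as ⇔
open import Relation.Binary.PropositionalEquality
  using (_≡_; refl; sym; trans; cong; cong₂; subst; module ≡-Reasoning)
open import Relation.Nullary using (¬_; Dec; yes; no; does)
open import Relation.Nullary.Decidable using (dec-true; dec-false; _×-dec_; _→-dec_; ¬?)

does-true : ∀ {P : Set} (d : Dec P) → does d ≡ true → P
does-true (yes p) _ = p
does-true (no _) ()

true≢false : ¬ true ≡ false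
true≢false ()

bool-case : (b : Bool) → b ≡ true ⊎ b ≡ false
bool-case true = inj₁ refl
bool-case false = inj₂ refl

bool-ext : ∀ {a b : Bool} → (a ≡ true → b ≡ true) → (b ≡ true → a ≡ true) → a ≡ b
bool-ext {false} {false} _ _ = refl
bool-ext {false} {true} _ g = g refl
bool-ext {true} {false} f _ = sym (f refl)
bool-ext {true} {true} _ _ = refl

-- GF(2)-sums.  The library's sums over the Boolean ring (xor, ∧) agree with
-- sumGF2, which lets us reuse its distributivity and permutation lemmas.

GF2 : CommutativeRing _ _
GF2 = BP.xor-∧-commutativeRing

module ΣGF2 = SemiringSum (CommutativeRing.semiring GF2)

sumGF2≡sum : ∀ {n} (f : Fin n → Bool) → sumGF2 f ≡ ΣGF2.sum f
sumGF2≡sum {zero} f = refl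
sumGF2≡sum {suc n} f = cong (f zero xor_) (sumGF2≡sum (λ i → f (suc i)))

sum-cong : ∀ {n} {f g : Fin n → Bool} → (∀ i → f i ≡ g i) → sumGF2 f ≡ sumGF2 g
sum-cong {zero} e = refl
sum-cong {suc n} e = cong₂ _xor_ (e zero) (sum-cong (λ i → e (suc i)))

sum-zero : ∀ {n} (f : Fin n → Bool) → (∀ i → f i ≡ false) → sumGF2 f ≡ false
sum-zero {zero} f e = refl
sum-zero {suc n} f e rewrite e zero = sum-zero (λ i → f (suc i)) (λ i → e (suc i))

sum-delta : ∀ {n} (f : Fin n → Bool) (z : Fin n) → (∀ i → ¬ i ≡ z → f i ≡ false) → sumGF2 f ≡ f z
sum-delta {suc n} f zero e =
  trans (cong (f zero xor_) (sum-zero _ (λ i → e (suc i) (λ ())))) (BP.xor-identityʳ (f zero))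
sum-delta {suc n} f (suc z) e rewrite e zero (λ ()) =
  sum-delta (λ i → f (suc i)) z (λ i ne → e (suc i) (λ q → ne (FinP.suc-injective q)))

sum-xor : ∀ {n} (f g : Fin n → Bool) → sumGF2 (λ i → f i xor g i) ≡ sumGF2 f xor sumGF2 g
sum-xor f g = begin
  sumGF2 (λ i → f i xor g i)     ≡⟨ sumGF2≡sum (λ i → f i xor g i) ⟩
  ΣGF2.sum (λ i → f i xor g i)   ≡⟨ ΣGF2.∑-distrib-+ f g ⟩
  ΣGF2.sum f xor ΣGF2.sum g      ≡⟨ sym (cong₂ _xor_ (sumGF2≡sum f) (sumGF2≡sum g)) ⟩
  sumGF2 f xor sumGF2 g          ∎
  where open ≡-Reasoning

sum-∧ˡ : ∀ {n} b (f : Fin n → Bool) → b ∧ sumGF2 f ≡ sumGF2 (λ i → b ∧ f i)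
sum-∧ˡ b f = begin
  b ∧ sumGF2 f                ≡⟨ cong (b ∧_) (sumGF2≡sum f) ⟩
  b ∧ ΣGF2.sum f              ≡⟨ ΣGF2.*-distribˡ-sum b f ⟩
  ΣGF2.sum (λ i → b ∧ f i)    ≡⟨ sym (sumGF2≡sum (λ i → b ∧ f i)) ⟩
  sumGF2 (λ i → b ∧ f i)      ∎
  where open ≡-Reasoning

sum-∧ʳ : ∀ {n} (f : Fin n → Bool) b → sumGF2 f ∧ b ≡ sumGF2 (λ i → f i ∧ b)
sum-∧ʳ f b = begin
  sumGF2 f ∧ b                ≡⟨ cong (_∧ b) (sumGF2≡sum f) ⟩
  ΣGF2.sum f ∧ b              ≡⟨ ΣGF2.*-distribʳ-sum b f ⟩
  ΣGF2.sum (λ i → f i ∧ b)    ≡⟨ sym (sumGF2≡sum (λ i → f i ∧ b)) ⟩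
  sumGF2 (λ i → f i ∧ b)      ∎
  where open ≡-Reasoning

sum-permute : ∀ {n m} (f : Fin m → Bool) (π : Fin n ↔ Fin m) →
  sumGF2 (λ i → f (Inverse.to π i)) ≡ sumGF2 f
sum-permute f π = begin
  sumGF2 (λ i → f (Inverse.to π i))     ≡⟨ sumGF2≡sum (λ i → f (Inverse.to π i)) ⟩
  ΣGF2.sum (λ i → f (Inverse.to π i))   ≡⟨ sym (ΣGF2.sum-permute f π) ⟩
  ΣGF2.sum f                        ≡⟨ sym (sumGF2≡sum f) ⟩
  sumGF2 f                          ∎
  where open ≡-Reasoning

sum-swap : ∀ {m n} (h : Fin m → Fin n → Bool) →
  sumGF2 (λ i → sumGF2 (λ j → h i j)) ≡ sumGF2 (λ j → sumGF2 (λ i → h i j))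
sum-swap {zero} {n} h = sym (sum-zero {n} _ (λ j → refl))
sum-swap {suc m} h rewrite sum-swap (λ i j → h (suc i) j) =
  sym (sum-xor (λ j → h zero j) (λ j → sumGF2 (λ i → h (suc i) j)))

sum-split : ∀ m {n} (f : Fin (m + n) → Bool) →
  sumGF2 f ≡ sumGF2 (λ i → f (i ↑ˡ n)) xor sumGF2 (λ j → f (m ↑ʳ j))
sum-split zero f = refl
sum-split (suc m) {n} f rewrite sum-split m {n} (λ i → f (suc i)) =
  sym (BP.xor-assoc (f zero) (sumGF2 (λ i → f (suc (i ↑ˡ n)))) (sumGF2 (λ j → f (suc (m ↑ʳ j)))))

sum-combine : ∀ p k (f : Fin (p * k) → Bool) →
  sumGF2 f ≡ sumGF2 {p} (λ v → sumGF2 {k} (λ t → f (combine {p} {k} v t)))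
sum-combine zero k f = refl
sum-combine (suc p) k f =
  trans (sum-split k {p * k} f)
        (cong (sumGF2 (λ t → f (t ↑ˡ (p * k))) xor_) (sum-combine p k (λ j → f (k ↑ʳ j))))

_≐_ : ∀ {n} → SubsetF n → SubsetF n → Set
S ≐ T = ∀ i → S i ≡ T i

_∖F_ : ∀ {n} → SubsetF n → SubsetF n → SubsetF n
(S ∖F T) i = S i ∧ not (T i)

∖-member : ∀ {n} (S T : SubsetF n) i → (S ∖F T) i ≡ true → S i ≡ true × T i ≡ false
∖-member S T i e with S i | T i
... | true | false = refl , refl

∖-intro : ∀ {n} (S T : SubsetF n) i → S i ≡ true → T i ≡ false → (S ∖F T) i ≡ true
∖-intro S T i si ti rewrite si | ti = refl

∖-⊆ : ∀ {n} (S T : SubsetF n) → (S ∖F T) ⊆F S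
∖-⊆ S T i e = proj₁ (∖-member S T i e)

∖-out : ∀ {n} (S T : SubsetF n) i → T i ≡ true → (S ∖F T) i ≡ false
∖-out S T i ti rewrite ti = BP.∧-zeroʳ (S i)

∖⁅⁆-member : ∀ {n} (S : SubsetF n) y z → (S ∖F ⁅ y ⁆F) z ≡ true → S z ≡ true × ¬ z ≡ y
∖⁅⁆-member S y z e with ∖-member S ⁅ y ⁆F z e
... | sz , nz = sz , λ z≡y → true≢false (trans (sym (dec-true (z ≟ y) z≡y)) nz)

∖⁅⁆-intro : ∀ {n} (S : SubsetF n) y z → S z ≡ true → ¬ z ≡ y → (S ∖F ⁅ y ⁆F) z ≡ true
∖⁅⁆-intro S y z sz ne = ∖-intro S ⁅ y ⁆F z sz (dec-false (z ≟ y) ne)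

∖⁅⁆-removed : ∀ {n} (S : SubsetF n) x → (S ∖F ⁅ x ⁆F) x ≡ false
∖⁅⁆-removed S x = ∖-out S ⁅ x ⁆F x (dec-true (x ≟ x) refl)

∖-split : ∀ {n} (S T : SubsetF n) → T ⊆F S → S ≐ (λ i → T i xor (S ∖F T) i)
∖-split S T t i with T i in ti
... | true rewrite t i ti = refl
... | false = sym (BP.∧-identityʳ (S i))

card-cong : ∀ {n} {S T : SubsetF n} → S ≐ T → ∣ S ∣F ≡ ∣ T ∣F
card-cong {zero} e = refl
card-cong {suc n} e =
  cong₂ _+_ (cong (λ b → if b then 1 else 0) (e zero)) (card-cong (λ i → e (suc i)))

card-∅ : ∀ {n} (S : SubsetF n) → (∀ i → S i ≡ false) → ∣ S ∣F ≡ 0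
card-∅ {zero} S e = refl
card-∅ {suc n} S e rewrite e zero = card-∅ (λ i → S (suc i)) (λ i → e (suc i))

card-⊆ : ∀ {n} (S T : SubsetF n) → S ⊆F T → ∣ S ∣F ≤ ∣ T ∣F
card-⊆ {zero} S T s = z≤n
card-⊆ {suc n} S T s with S zero in eS | T zero in eT
... | false | false = card-⊆ (λ i → S (suc i)) (λ i → T (suc i)) (λ i → s (suc i))
... | false | true = ℕP.m≤n⇒m≤1+n (card-⊆ (λ i → S (suc i)) (λ i → T (suc i)) (λ i → s (suc i)))
... | true | true = s≤s (card-⊆ (λ i → S (suc i)) (λ i → T (suc i)) (λ i → s (suc i)))
... | true | false = ⊥-elim (true≢false (trans (sym (s zero eS)) eT))

card-⊂ : ∀ {n} (S T : SubsetF n) → S ⊆F T → (x : Fin n) → T x ≡ true → S x ≡ false →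
  ∣ S ∣F < ∣ T ∣F
card-⊂ {suc n} S T s zero tx sx rewrite tx | sx =
  s≤s (card-⊆ (λ i → S (suc i)) (λ i → T (suc i)) (λ i → s (suc i)))
card-⊂ {suc n} S T s (suc x) tx sx with S zero in eS | T zero in eT
... | false | false = card-⊂ (λ i → S (suc i)) (λ i → T (suc i)) (λ i → s (suc i)) x tx sx
... | false | true = ℕP.m≤n⇒m≤1+n (card-⊂ (λ i → S (suc i)) (λ i → T (suc i)) (λ i → s (suc i)) x tx sx)
... | true | true = s≤s (card-⊂ (λ i → S (suc i)) (λ i → T (suc i)) (λ i → s (suc i)) x tx sx)
... | true | false = ⊥-elim (true≢false (trans (sym (s zero eS)) eT))

card-insert : ∀ {n} (S : SubsetF n) (x : Fin n) → S x ≡ false → ∣ S ∪F ⁅ x ⁆F ∣F ≡ suc ∣ S ∣F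
card-insert {suc n} S zero sx rewrite sx = cong suc (card-cong (λ i → BP.∨-identityʳ (S (suc i))))
card-insert {suc n} S (suc x) sx rewrite BP.∨-identityʳ (S zero) with S zero
... | false = card-insert (λ i → S (suc i)) x sx
... | true = cong suc (card-insert (λ i → S (suc i)) x sx)

card-remove : ∀ {n} (S : SubsetF n) (x : Fin n) → S x ≡ true → ∣ S ∣F ≡ suc ∣ S ∖F ⁅ x ⁆F ∣F
card-remove S x sx =
  trans (card-cong reinsert) (card-insert (S ∖F ⁅ x ⁆F) x (∖⁅⁆-removed S x))
  where
  reinsert : S ≐ ((S ∖F ⁅ x ⁆F) ∪F ⁅ x ⁆F)
  reinsert i with i ≟ x
  ... | yes refl rewrite sx = refl
  ... | no _ = sym (trans (BP.∨-identityʳ _) (BP.∧-identityʳ (S i)))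

card-single : ∀ {n} (x : Fin n) → ∣ ⁅ x ⁆F ∣F ≡ 1
card-single {n} x = trans (card-insert ∅F x refl) (cong suc (card-∅ {n} ∅F (λ _ → refl)))

card-≤1 : ∀ {n} (S : SubsetF n) (x : Fin n) → S ⊆F ⁅ x ⁆F → ∣ S ∣F ≤ 1
card-≤1 S x s = subst (∣ S ∣F ≤_) (card-single x) (card-⊆ S ⁅ x ⁆F s)

nonempty : ∀ {n} (S : SubsetF n) {c} → ∣ S ∣F ≡ suc c → ∃ λ x → S x ≡ true
nonempty S c with any? (λ x → S x BP.≟ true)
... | yes found = found
... | no none = ⊥-elim (ℕP.0≢1+n (trans (sym (card-∅ S absent)) c))
  where
  absent : ∀ x → S x ≡ false
  absent x with bool-case (S x)
  ... | inj₁ e = ⊥-elim (none (x , e))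
  ... | inj₂ e = e

card-pred : ∀ {n} (S : SubsetF n) {c} x → ∣ S ∣F ≡ suc c → S x ≡ true → ∣ S ∖F ⁅ x ⁆F ∣F ≡ c
card-pred S x c sx = ℕP.suc-injective (trans (sym (card-remove S x sx)) c)

record Enumeration3 {n} (S : SubsetF n) : Set where
  field
    elem           : Fin 3 → Fin n
    elem-∈         : ∀ t → S (elem t) ≡ true
    elem-injective : ∀ t t' → elem t ≡ elem t' → t ≡ t'
    elem-onto      : ∀ x → S x ≡ true → ∃ λ t → elem t ≡ x

enumerate3 : ∀ {n} (S : SubsetF n) (x : Fin n) → ∣ S ∣F ≡ 3 → S x ≡ true →
  Σ (Enumeration3 S) λ E → Enumeration3.elem E zero ≡ x
enumerate3 S x c₀ s₀ = record { elem = elem ; elem-∈ = elem-∈ ; elem-injective = inj ; elem-onto = onto } , refl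
  where
  S₁ = S ∖F ⁅ x ⁆F
  c₁ = card-pred S x c₀ s₀
  x₁ = proj₁ (nonempty S₁ c₁)
  s₁ = proj₂ (nonempty S₁ c₁)
  S₂ = S₁ ∖F ⁅ x₁ ⁆F
  c₂ = card-pred S₁ x₁ c₁ s₁
  x₂ = proj₁ (nonempty S₂ c₂)
  s₂ = proj₂ (nonempty S₂ c₂)
  S₃ = S₂ ∖F ⁅ x₂ ⁆F
  c₃ = card-pred S₂ x₂ c₂ s₂
  m₁ = ∖⁅⁆-member S x x₁ s₁
  m₂ = ∖⁅⁆-member S₁ x₁ x₂ s₂
  m₂′ = ∖⁅⁆-member S x x₂ (proj₁ m₂)
  elem : Fin 3 → Fin _
  elem zero = x
  elem (suc zero) = x₁
  elem (suc (suc zero)) = x₂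
  elem-∈ : ∀ t → S (elem t) ≡ true
  elem-∈ zero = s₀
  elem-∈ (suc zero) = proj₁ m₁
  elem-∈ (suc (suc zero)) = proj₁ m₂′
  inj : ∀ t t' → elem t ≡ elem t' → t ≡ t'
  inj zero zero e = refl
  inj zero (suc zero) e = ⊥-elim (proj₂ m₁ (sym e))
  inj zero (suc (suc zero)) e = ⊥-elim (proj₂ m₂′ (sym e))
  inj (suc zero) zero e = ⊥-elim (proj₂ m₁ e)
  inj (suc zero) (suc zero) e = refl
  inj (suc zero) (suc (suc zero)) e = ⊥-elim (proj₂ m₂ (sym e))
  inj (suc (suc zero)) zero e = ⊥-elim (proj₂ m₂′ e)
  inj (suc (suc zero)) (suc zero) e = ⊥-elim (proj₂ m₂ e)
  inj (suc (suc zero)) (suc (suc zero)) e = refl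
  onto : ∀ z → S z ≡ true → ∃ λ t → elem t ≡ z
  onto z sz with z ≟ x | z ≟ x₁ | z ≟ x₂
  ... | yes e | _ | _ = zero , sym e
  ... | no _ | yes e | _ = suc zero , sym e
  ... | no _ | no _ | yes e = suc (suc zero) , sym e
  ... | no n₀ | no n₁ | no n₂ = ⊥-elim (ℕP.0≢1+n (trans (sym c₃) (card-remove S₃ z z∈S₃)))
    where
    z∈S₃ : S₃ z ≡ true
    z∈S₃ = ∖⁅⁆-intro S₂ x₂ z (∖⁅⁆-intro S₁ x₁ z (∖⁅⁆-intro S x z sz n₀) n₁) n₂

module Σℕ = CommutativeMonoidSum ℕP.+-0-commutativeMonoid

Σℕ-delta : ∀ {k} (f : Fin k → ℕ) (c : Fin k) → (∀ j → ¬ j ≡ c → f j ≡ 0) → Σℕ.sum f ≡ f c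
Σℕ-delta {suc k} f zero e =
  trans (cong (f zero +_) (trans (Σℕ.sum-cong-≗ (λ j → e (suc j) (λ ()))) (Σℕ.sum-replicate-zero k)))
        (ℕP.+-identityʳ (f zero))
Σℕ-delta {suc k} f (suc c) e rewrite e zero (λ ()) =
  Σℕ-delta (λ j → f (suc j)) c (λ j ne → e (suc j) (λ q → ne (FinP.suc-injective q)))

Σℕ-ones : ∀ {k} (f : Fin k → ℕ) → (∀ j → f j ≡ 1) → Σℕ.sum f ≡ k
Σℕ-ones {zero} f e = refl
Σℕ-ones {suc k} f e rewrite e zero = cong suc (Σℕ-ones (λ j → f (suc j)) (λ j → e (suc j)))

card-partition : ∀ {n k} (cls : Fin n → Fin k) (S : SubsetF n) →
  ∣ S ∣F ≡ Σℕ.sum (λ j → ∣ S ∩F classOf cls j ∣F)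
card-partition {zero} {k} cls S = sym (Σℕ.sum-replicate-zero k)
card-partition {suc n} {k} cls S = begin
  (if S zero then 1 else 0) + ∣ S′ ∣F
    ≡⟨ cong₂ _+_ (sym (trans (Σℕ-delta first (cls zero) first-elsewhere) first-here))
                 (card-partition (λ i → cls (suc i)) S′) ⟩
  Σℕ.sum first + Σℕ.sum (λ j → ∣ S′ ∩F classOf (λ i → cls (suc i)) j ∣F)
    ≡⟨ sym (Σℕ.∑-distrib-+ first (λ j → ∣ S′ ∩F classOf (λ i → cls (suc i)) j ∣F)) ⟩
  Σℕ.sum (λ j → ∣ S ∩F classOf cls j ∣F) ∎
  where
  open ≡-Reasoning
  S′ : SubsetF n
  S′ i = S (suc i)
  first : Fin k → ℕ
  first j = if S zero ∧ does (cls zero ≟ j) then 1 else 0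
  first-elsewhere : ∀ j → ¬ j ≡ cls zero → first j ≡ 0
  first-elsewhere j ne rewrite dec-false (cls zero ≟ j) (λ q → ne (sym q)) | BP.∧-zeroʳ (S zero) = refl
  first-here : first (cls zero) ≡ (if S zero then 1 else 0)
  first-here rewrite dec-true (cls zero ≟ cls zero) refl | BP.∧-identityʳ (S zero) = refl

module Transversals {n k} (cls : Fin n → Fin k) where

  -- The set {sel j | j} of elements picked by a choice function sel.
  Transversal : (Fin k → Fin n) → SubsetF n
  Transversal sel z = does (z ≟ sel (cls z))

  meets-once : ∀ sel (S : SubsetF n) → S ⊆F Transversal sel → ∀ j → ∣ S ∩F classOf cls j ∣F ≤ 1
  meets-once sel S s j = card-≤1 (S ∩F classOf cls j) (sel j) picked
    where
    picked : (S ∩F classOf cls j) ⊆F ⁅ sel j ⁆F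
    picked z q with does-true (cls z ≟ j) (BP.∧-conicalʳ (S z) _ q)
    ... | refl = s z (BP.∧-conicalˡ (S z) _ q)

  transversal-card : ∀ sel → (∀ j → cls (sel j) ≡ j) → ∣ Transversal sel ∣F ≡ k
  transversal-card sel sel-cls = trans (card-partition cls (Transversal sel)) (Σℕ-ones _ one)
    where
    one : ∀ j → ∣ Transversal sel ∩F classOf cls j ∣F ≡ 1
    one j = trans (card-cong trace) (card-single (sel j))
      where
      trace : (Transversal sel ∩F classOf cls j) ≐ ⁅ sel j ⁆F
      trace z with cls z ≟ j
      ... | yes refl = BP.∧-identityʳ _
      ... | no ne = trans (BP.∧-zeroʳ _) (sym (dec-false (z ≟ sel j) (λ { refl → ne (sel-cls j) })))

colSum-cong : ∀ {m n} (A : Matrix m n) {S T : SubsetF n} → S ≐ T → ∀ r → colSum A S r ≡ colSum A T r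
colSum-cong A e r = sum-cong (λ i → cong (_∧ A r i) (e i))

colSum-xor : ∀ {m n} (A : Matrix m n) (S T : SubsetF n) r →
  colSum A (λ i → S i xor T i) r ≡ colSum A S r xor colSum A T r
colSum-xor A S T r =
  trans (sum-cong (λ i → BP.∧-distribʳ-xor (A r i) (S i) (T i))) (sum-xor (λ i → S i ∧ A r i) (λ i → T i ∧ A r i))

colSum-∅ : ∀ {m n} (A : Matrix m n) (S : SubsetF n) → (∀ i → S i ≡ false) → ∀ r → colSum A S r ≡ false
colSum-∅ A S e r = sum-zero _ (λ i → cong (_∧ A r i) (e i))

colSum-isolated : ∀ {m n} (A : Matrix m n) (S : SubsetF n) x r →
  (∀ e → S e ≡ true → ¬ e ≡ x → A r e ≡ false) → colSum A S r ≡ S x ∧ A r x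
colSum-isolated A S x r vanish = sum-delta (λ e → S e ∧ A r e) x off-x
  where
  off-x : ∀ e → ¬ e ≡ x → S e ∧ A r e ≡ false
  off-x e ne with bool-case (S e)
  ... | inj₁ se rewrite se = vanish e se ne
  ... | inj₂ se rewrite se = refl

colSum-single : ∀ {m n} (A : Matrix m n) x r → colSum A ⁅ x ⁆F r ≡ A r x
colSum-single A x r =
  trans (colSum-isolated A ⁅ x ⁆F x r (λ e ee ne → ⊥-elim (ne (does-true (e ≟ x) ee))))
        (cong (_∧ A r x) (dec-true (x ≟ x) refl))

LinIndep-⊆ : ∀ {m n} (A : Matrix m n) {S S′ : SubsetF n} → S ⊆F S′ → LinIndepCols A S′ → LinIndepCols A S
LinIndep-⊆ A s li T t z = li T (λ i ti → s i (t i ti)) z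

LinIndep-pointwise : ∀ {m n} (A A′ : Matrix m n) → (∀ r e → A r e ≡ A′ r e) → ∀ S →
  LinIndepCols A S ⇔ LinIndepCols A′ S
LinIndep-pointwise A A′ same S = mk⇔
  (λ li T s z → li T s (λ r → trans (sum-cong (λ e → cong (T e ∧_) (same r e))) (z r)))
  (λ li T s z → li T s (λ r → trans (sum-cong (λ e → cong (T e ∧_) (sym (same r e)))) (z r)))

extend-indep : ∀ {m n} (A : Matrix m n) (S : SubsetF n) → LinIndepCols A S → ∀ x r →
  A r x ≡ true → (∀ e → S e ≡ true → A r e ≡ false) → LinIndepCols A (S ∪F ⁅ x ⁆F)
extend-indep A S li x r detects vanish T t z = li T T⊆S z
  where
  in-S : ∀ e → T e ≡ true → ¬ e ≡ x → S e ≡ true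
  in-S e te ne = trans (sym (BP.∨-identityʳ (S e))) (subst (λ b → S e ∨ b ≡ true) (dec-false (e ≟ x) ne) (t e te))
  Tx : T x ≡ false
  Tx = begin
    T x            ≡⟨ sym (BP.∧-identityʳ (T x)) ⟩
    T x ∧ true     ≡⟨ cong (T x ∧_) (sym detects) ⟩
    T x ∧ A r x    ≡⟨ sym (colSum-isolated A T x r (λ e te ne → vanish e (in-S e te ne))) ⟩
    colSum A T r   ≡⟨ z r ⟩
    false          ∎
    where open ≡-Reasoning
  T⊆S : T ⊆F S
  T⊆S e te with e ≟ x
  ... | yes refl = ⊥-elim (true≢false (trans (sym te) Tx))
  ... | no ne = in-S e te ne

IsDependency : ∀ {m n} → Matrix m n → SubsetF n → SubsetF n → Set
IsDependency A S T = T ⊆F S × (∀ r → colSum A T r ≡ false) × ∃ λ i → T i ≡ true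

Dependency : ∀ {m n} → Matrix m n → SubsetF n → Set
Dependency A S = Σ (SubsetF _) (IsDependency A S)

IsDependency? : ∀ {m n} (A : Matrix m n) (S T : SubsetF n) → Dec (IsDependency A S T)
IsDependency? A S T = all? (λ i → (T i BP.≟ true) →-dec (S i BP.≟ true))
  ×-dec (all? (λ r → colSum A T r BP.≟ false) ×-dec any? (λ i → T i BP.≟ true))

IsDependency-resp : ∀ {m n} (A : Matrix m n) (S : SubsetF n) {T T′} → T ≐ T′ →
  IsDependency A S T → IsDependency A S T′
IsDependency-resp A S e (s , z , i , ti) =
  (λ x t → s x (trans (e x) t)) , (λ r → trans (sym (colSum-cong A e r)) (z r)) , i , trans (sym (e i)) ti

dependency? : ∀ {m n} (A : Matrix m n) (S : SubsetF n) → Dec (Dependency A S)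
dependency? A S with anySubset? (λ v → IsDependency? A S (lookup v))
... | yes (v , d) = yes (lookup v , d)
... | no none = no λ (T , d) →
  none (tabulate T , IsDependency-resp A S (λ i → sym (lookup∘tabulate T i)) d)

dependency⇒¬LinIndep : ∀ {m n} (A : Matrix m n) (S : SubsetF n) → Dependency A S → ¬ LinIndepCols A S
dependency⇒¬LinIndep A S (T , s , z , i , ti) li = true≢false (trans (sym ti) (li T s z i))

¬dependency⇒LinIndep : ∀ {m n} (A : Matrix m n) (S : SubsetF n) → ¬ Dependency A S → LinIndepCols A S
¬dependency⇒LinIndep A S nd T s z i with bool-case (T i)
... | inj₁ e = ⊥-elim (nd (T , s , z , i , e))
... | inj₂ e = e

LinIndep? : ∀ {m n} (A : Matrix m n) (S : SubsetF n) → Dec (LinIndepCols A S)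
LinIndep? A S with dependency? A S
... | yes d = no (dependency⇒¬LinIndep A S d)
... | no nd = yes (¬dependency⇒LinIndep A S nd)

¬LinIndep⇒dependency : ∀ {m n} (A : Matrix m n) (S : SubsetF n) → ¬ LinIndepCols A S → Dependency A S
¬LinIndep⇒dependency A S ni with dependency? A S
... | yes d = d
... | no nd = ⊥-elim (ni (¬dependency⇒LinIndep A S nd))

Spans : ∀ {m n} → Matrix m n → SubsetF n → Fin n → Set
Spans A B x = Σ (SubsetF _) λ C → C ⊆F B × ∀ r → colSum A C r ≡ A r x

span⇒dependent : ∀ {m n} (A : Matrix m n) (B : SubsetF n) x → B x ≡ false → Spans A B x →
  ¬ LinIndepCols A (B ∪F ⁅ x ⁆F)
span⇒dependent A B x bx (C , C⊆B , sums) li = true≢false (trans (sym Dx) (li D D⊆ Dz x))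
  where
  -- D = C + x is a zero-sum set containing x
  D : SubsetF _
  D e = does (e ≟ x) xor C e
  x∉C : C x ≡ false
  x∉C with bool-case (C x)
  ... | inj₁ cx = ⊥-elim (true≢false (trans (sym (C⊆B x cx)) bx))
  ... | inj₂ cx = cx
  Dx : D x ≡ true
  Dx rewrite dec-true (x ≟ x) refl | x∉C = refl
  D⊆ : D ⊆F (B ∪F ⁅ x ⁆F)
  D⊆ e q with does (e ≟ x) | C e in ce
  ... | true | _ = BP.∨-zeroʳ (B e)
  ... | false | true = trans (BP.∨-identityʳ (B e)) (C⊆B e ce)
  Dz : ∀ r → colSum A D r ≡ false
  Dz r = begin
    colSum A D r                          ≡⟨ colSum-xor A ⁅ x ⁆F C r ⟩
    colSum A ⁅ x ⁆F r xor colSum A C r    ≡⟨ cong₂ _xor_ (colSum-single A x r) (sums r) ⟩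
    A r x xor A r x                       ≡⟨ BP.xor-same (A r x) ⟩
    false                                 ∎
    where open ≡-Reasoning

xor-zero⇒≡ : ∀ a b → a xor b ≡ false → b ≡ a
xor-zero⇒≡ false b e = e
xor-zero⇒≡ true true _ = refl

dependent⇒span : ∀ {m n} (A : Matrix m n) (B : SubsetF n) x → LinIndepCols A B →
  ¬ LinIndepCols A (B ∪F ⁅ x ⁆F) → Spans A B x
dependent⇒span A B x liB dep with ¬LinIndep⇒dependency A (B ∪F ⁅ x ⁆F) dep
... | T , T⊆ , Tz , i , ti = T ∖F ⁅ x ⁆F , rest⊆B , sums
  where
  rest⊆B : (T ∖F ⁅ x ⁆F) ⊆F B
  rest⊆B e q with ∖⁅⁆-member T x e q
  ... | te , ne = trans (sym (BP.∨-identityʳ (B e))) (subst (λ b → B e ∨ b ≡ true) (dec-false (e ≟ x) ne) (T⊆ e te))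
  -- x occurs in the dependency, since B alone is independent
  Tx : T x ≡ true
  Tx with bool-case (T x)
  ... | inj₁ tx = tx
  ... | inj₂ tx = ⊥-elim (true≢false (trans (sym ti) (liB T T⊆B Tz i)))
    where
    T⊆B : T ⊆F B
    T⊆B e te with e ≟ x
    ... | yes refl = ⊥-elim (true≢false (trans (sym te) tx))
    ... | no ne = rest⊆B e (∖⁅⁆-intro T x e te ne)
  x⊆T : ⁅ x ⁆F ⊆F T
  x⊆T e q with does-true (e ≟ x) q
  ... | refl = Tx
  sums : ∀ r → colSum A (T ∖F ⁅ x ⁆F) r ≡ A r x
  sums r = xor-zero⇒≡ (A r x) (colSum A (T ∖F ⁅ x ⁆F) r) (begin
    A r x xor colSum A (T ∖F ⁅ x ⁆F) r               ≡⟨ cong (_xor colSum A (T ∖F ⁅ x ⁆F) r) (sym (colSum-single A x r)) ⟩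
    colSum A ⁅ x ⁆F r xor colSum A (T ∖F ⁅ x ⁆F) r   ≡⟨ sym (colSum-xor A ⁅ x ⁆F (T ∖F ⁅ x ⁆F) r) ⟩
    colSum A (λ e → ⁅ x ⁆F e xor (T ∖F ⁅ x ⁆F) e) r  ≡⟨ sym (colSum-cong A (∖-split T ⁅ x ⁆F x⊆T) r) ⟩
    colSum A T r                                     ≡⟨ Tz r ⟩
    false                                            ∎)
    where open ≡-Reasoning

Covers : ∀ {n} → SubsetF n → List (SubsetF n) → Set
Covers X Cs = ∀ x → X x ≡ true ⇔ Any (λ C → C x ≡ true) Cs

covers-rest : ∀ {n} (X C : SubsetF n) Cs → All (DisjointF C) Cs → Covers X (C ∷ Cs) → Covers (X ∖F C) Cs
covers-rest X C Cs disjoint cov x = mk⇔ to from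
  where
  outside-C : Any (λ C′ → C′ x ≡ true) Cs → C x ≡ false
  outside-C a with bool-case (C x)
  ... | inj₂ cx = cx
  ... | inj₁ cx = ⊥-elim (hit disjoint a)
    where
    hit : ∀ {Ds} → All (DisjointF C) Ds → Any (λ C′ → C′ x ≡ true) Ds → ⊥
    hit (d ∷ _) (here px) = true≢false (trans (sym px) (d x cx))
    hit (_ ∷ ds) (there a′) = hit ds a′
  to : (X ∖F C) x ≡ true → Any (λ C′ → C′ x ≡ true) Cs
  to q with ∖-member X C x q
  ... | xx , cx with Equivalence.to (cov x) xx
  ... | here px = ⊥-elim (true≢false (trans (sym px) cx))
  ... | there a = a
  from : Any (λ C′ → C′ x ≡ true) Cs → (X ∖F C) x ≡ true
  from a = ∖-intro X C x (Equivalence.from (cov x) (there a)) (outside-C a)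

covers-cons : ∀ {n} (X C : SubsetF n) Cs → C ⊆F X → Covers (X ∖F C) Cs → Covers X (C ∷ Cs)
covers-cons X C Cs C⊆X cov x = mk⇔ to from
  where
  to : X x ≡ true → Any (λ C′ → C′ x ≡ true) (C ∷ Cs)
  to xx with C x in cx
  ... | true = here cx
  ... | false = there (Equivalence.to (cov x) (∖-intro X C x xx cx))
  from : Any (λ C′ → C′ x ≡ true) (C ∷ Cs) → X x ≡ true
  from (here px) = C⊆X x px
  from (there a) = ∖-⊆ X C x (Equivalence.from (cov x) a)

module Represented {m n} (M : Matroid n) (A : Matrix m n) (rep : RepresentedBy M A) where

  toLI : ∀ {S} → Indep M S → LinIndepCols A S
  toLI {S} = Equivalence.to (rep S)

  fromLI : ∀ {S} → LinIndepCols A S → Indep M S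
  fromLI {S} = Equivalence.from (rep S)

  ZeroSum : SubsetF n → Set
  ZeroSum X = ∀ r → colSum A X r ≡ false

  circuit-nonempty : ∀ C → IsCircuit M C → ∃ λ x → C x ≡ true
  circuit-nonempty C (dep , _) with ¬LinIndep⇒dependency A C (λ li → dep (fromLI li))
  ... | T , T⊆C , _ , i , ti = i , T⊆C i ti

  -- The columns of a circuit sum to zero: a dependency inside a circuit is
  -- the whole circuit, since every proper subset is independent.
  circuit-sum : ∀ C → IsCircuit M C → ZeroSum C
  circuit-sum C (dep , minimal) with ¬LinIndep⇒dependency A C (λ li → dep (fromLI li))
  ... | T , T⊆C , Tz , i , ti with any? (λ x → (C x BP.≟ true) ×-dec (T x BP.≟ false))
  ...   | yes missing = ⊥-elim (dependency⇒¬LinIndep A T (T , (λ _ t → t) , Tz , i , ti) (toLI (minimal T T⊆C missing)))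
  ...   | no none = λ r → trans (colSum-cong A (λ x → bool-ext (C⊆T x) (T⊆C x)) r) (Tz r)
    where
    C⊆T : C ⊆F T
    C⊆T x cx with bool-case (T x)
    ... | inj₁ tx = tx
    ... | inj₂ tx = ⊥-elim (none (x , cx , tx))

  cycle-sum : ∀ X → InCycleSpace M X → ZeroSum X
  cycle-sum X (Cs , circuits , disjoint , cov) = go Cs circuits disjoint X cov
    where
    go : ∀ Cs → All (IsCircuit M) Cs → AllPairs DisjointF Cs → ∀ X → Covers X Cs → ZeroSum X
    go [] _ _ X cov = colSum-∅ A X nothing
      where
      nothing : ∀ x → X x ≡ false
      nothing x with bool-case (X x)
      ... | inj₂ e = e
      ... | inj₁ e with Equivalence.to (cov x) e
      ... | ()
    go (C ∷ Cs) (c ∷ cs) (d ∷ ds) X cov r = begin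
      colSum A X r                               ≡⟨ colSum-cong A (∖-split X C C⊆X) r ⟩
      colSum A (λ i → C i xor (X ∖F C) i) r      ≡⟨ colSum-xor A C (X ∖F C) r ⟩
      colSum A C r xor colSum A (X ∖F C) r       ≡⟨ cong₂ _xor_ (circuit-sum C c r) (go Cs cs ds (X ∖F C) (covers-rest X C Cs d cov) r) ⟩
      false                                      ∎
      where
      open ≡-Reasoning
      C⊆X : C ⊆F X
      C⊆X x cx = Equivalence.from (cov x) (here cx)

  -- Every dependent set contains a circuit: remove elements while the set
  -- stays dependent; a set where no removal stays dependent is a circuit
  -- (fuel bounds the size of D).
  circuit-within : ∀ D → ¬ LinIndepCols A D → Σ (SubsetF n) λ C → C ⊆F D × IsCircuit M C
  circuit-within D = shrink ∣ D ∣F D ℕP.≤-refl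
    where
    shrink : ∀ fuel D → ∣ D ∣F ≤ fuel → ¬ LinIndepCols A D → Σ (SubsetF n) λ C → C ⊆F D × IsCircuit M C
    shrink fuel D bound nd with any? (λ x → (D x BP.≟ true) ×-dec ¬? (LinIndep? A (D ∖F ⁅ x ⁆F)))
    shrink fuel D bound nd | no none = D , (λ _ t → t) , (λ i → nd (toLI i)) , minimal
      where
      minimal : ∀ D′ → D′ ⊆F D → (∃ λ x → D x ≡ true × D′ x ≡ false) → Indep M D′
      minimal D′ sub (x , dx , d′x) with LinIndep? A (D ∖F ⁅ x ⁆F)
      ... | no ni = ⊥-elim (none (x , dx , ni))
      ... | yes li = fromLI (LinIndep-⊆ A inside li)
        where
        inside : D′ ⊆F (D ∖F ⁅ x ⁆F)
        inside e q = ∖⁅⁆-intro D x e (sub e q) λ { refl → true≢false (trans (sym q) d′x) }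
    shrink fuel D bound nd | yes (x , dx , nd′)
      with fuel | ℕP.≤-trans (card-⊂ (D ∖F ⁅ x ⁆F) D (∖-⊆ D ⁅ x ⁆F) x dx (∖⁅⁆-removed D x)) bound
    ... | suc fuel′ | smaller with shrink fuel′ (D ∖F ⁅ x ⁆F) (ℕP.≤-pred smaller) nd′
    ...   | C , C⊆ , circuit = C , (λ i t → ∖-⊆ D ⁅ x ⁆F i (C⊆ i t)) , circuit

  Decomposition : SubsetF n → Set
  Decomposition X = Σ (List (SubsetF n)) λ Cs →
    All (IsCircuit M) Cs × AllPairs DisjointF Cs × Covers X Cs × All (_⊆F X) Cs

  remove-circuit : ∀ X C → ZeroSum X → C ⊆F X → IsCircuit M C → ZeroSum (X ∖F C)
  remove-circuit X C z C⊆X circuit r = xor-zero⇒≡ false (colSum A (X ∖F C) r) (begin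
    false xor colSum A (X ∖F C) r              ≡⟨ cong (_xor colSum A (X ∖F C) r) (sym (circuit-sum C circuit r)) ⟩
    colSum A C r xor colSum A (X ∖F C) r       ≡⟨ sym (colSum-xor A C (X ∖F C) r) ⟩
    colSum A (λ i → C i xor (X ∖F C) i) r      ≡⟨ sym (colSum-cong A (∖-split X C C⊆X) r) ⟩
    colSum A X r                               ≡⟨ z r ⟩
    false                                      ∎)
    where open ≡-Reasoning

  -- Every zero-sum set decomposes: split off a circuit and recurse on the
  -- smaller zero-sum remainder (fuel bounds the size of X).
  decompose : ∀ fuel X → ∣ X ∣F ≤ fuel → ZeroSum X → Decomposition X
  decompose fuel X bound z with any? (λ x → X x BP.≟ true)
  ... | no none = [] , [] , [] , (λ x → mk⇔ (λ e → ⊥-elim (none (x , e))) (λ ())) , []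
  ... | yes (x , xx) with circuit-within X (dependency⇒¬LinIndep A X (X , (λ _ t → t) , z , x , xx))
  ...   | C , C⊆X , circuit with circuit-nonempty C circuit
  ...     | y , cy with fuel | ℕP.≤-trans (card-⊂ (X ∖F C) X (∖-⊆ X C) y (C⊆X y cy) (∖-out X C y cy)) bound
  ...       | suc fuel′ | smaller with decompose fuel′ (X ∖F C) (ℕP.≤-pred smaller) (remove-circuit X C z C⊆X circuit)
  ...         | Cs , circuits , disjoint , cov , inside =
    C ∷ Cs , circuit ∷ circuits , All.map apart inside ∷ disjoint , covers-cons X C Cs C⊆X cov ,
    C⊆X ∷ All.map (λ s i t → ∖-⊆ X C i (s i t)) inside
    where
    apart : ∀ {C′} → C′ ⊆F (X ∖F C) → DisjointF C C′
    apart {C′} s i ci with bool-case (C′ i)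
    ... | inj₂ e = e
    ... | inj₁ e = ⊥-elim (true≢false (trans (sym ci) (proj₂ (∖-member X C i (s i e)))))

  zero-sum⇒cycle : ∀ X → ZeroSum X → InCycleSpace M X
  zero-sum⇒cycle X z with decompose ∣ X ∣F X ℕP.≤-refl z
  ... | Cs , circuits , disjoint , cov , _ = Cs , circuits , disjoint , cov

  -- If an independent set Φ spans every column, then no independent set is
  -- larger than Φ (otherwise augmenting Φ would add a spanned column).
  rank-bound : ∀ Φ → Indep M Φ → (∀ x → Spans A Φ x) → RankAtMost M ∣ Φ ∣F
  rank-bound Φ indΦ span S indS with ∣ S ∣F ≤? ∣ Φ ∣F
  ... | yes le = le
  ... | no nle with indep-aug M Φ S indΦ indS (ℕP.≰⇒> nle)
  ... | x , _ , Φx , ind = ⊥-elim (span⇒dependent A Φ x Φx (span x) (toLI ind))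

module Relabel {m n n′} (B : Matrix m n′) (π : Fin n ↔ Fin n′) where

  open Inverse π using (to; from; strictlyInverseˡ; strictlyInverseʳ)

  relabelled : Matrix m n
  relabelled r e = B r (to e)

  colSum-relabel : ∀ (T : SubsetF n′) r → colSum relabelled (λ e → T (to e)) r ≡ colSum B T r
  colSum-relabel T r = sum-permute (λ l → T l ∧ B r l) π

  relabel : ∀ S → LinIndepCols B (λ l → S (from l)) ⇔ LinIndepCols relabelled S
  relabel S = mk⇔ forward backward
    where
    forward : LinIndepCols B (λ l → S (from l)) → LinIndepCols relabelled S
    forward li T s z i = trans (cong T (sym (strictlyInverseʳ i))) (li (λ l → T (from l)) (λ l t → s (from l) t) z′ (to i))
      where
      z′ : ∀ r → colSum B (λ l → T (from l)) r ≡ false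
      z′ r = trans (sym (colSum-relabel (λ l → T (from l)) r))
               (trans (colSum-cong relabelled (λ e → cong T (strictlyInverseʳ e)) r) (z r))
    backward : LinIndepCols relabelled S → LinIndepCols B (λ l → S (from l))
    backward li T s z l = trans (cong T (sym (strictlyInverseˡ l))) (li (λ e → T (to e)) s′ z′ (from l))
      where
      s′ : (λ e → T (to e)) ⊆F S
      s′ e t = subst (λ x → S x ≡ true) (strictlyInverseʳ e) (s (to e) t)
      z′ : ∀ r → colSum relabelled (λ e → T (to e)) r ≡ false
      z′ r = trans (colSum-relabel T r) (z r)

-- Entry of IAS(G) in row r and the column φ, χ or ψ (t = 0, 1, 2) of vertex v.
iasEntry : ∀ {p} → (Fin p → Fin p → Bool) → Fin p → Fin p → Fin 3 → Bool
iasEntry a r v zero = does (r ≟ v)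
iasEntry a r v (suc zero) = a r v
iasEntry a r v (suc (suc zero)) = a r v xor does (r ≟ v)

IAS-entry : ∀ {p} (G : LoopedSimpleGraph p) r l →
  IAS G r l ≡ iasEntry (adj G) r (proj₁ (remQuot {p} 3 l)) (proj₂ (remQuot {p} 3 l))
IAS-entry {p} G r l with quotRem {p} 3 l
... | zero , v = refl
... | suc zero , v = refl
... | suc (suc zero) , v = refl

IAS-combine : ∀ {p} (G : LoopedSimpleGraph p) r v t → IAS G r (combine v t) ≡ iasEntry (adj G) r v t
IAS-combine {p} G r v t =
  trans (IAS-entry G r (combine {p} {3} v t)) (cong (λ q → iasEntry (adj G) r (proj₁ q) (proj₂ q)) (remQuot-combine {p} {3} v t))

-- φ + χ + ψ = 0 in every row: ψ_G(v) = φ_G(v) + χ_G(v).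
triple-cancels : ∀ {p} (a : Fin p → Fin p → Bool) r v → sumGF2 (iasEntry a r v) ≡ false
triple-cancels a r v with a r v | does (r ≟ v)
... | false | false = refl
... | false | true = refl
... | true | false = refl
... | true | true = refl

vertex-triple-sum : ∀ {p} (G : LoopedSimpleGraph p) v r →
  colSum (IAS G) (λ l → does (vertexOf {p} l ≟ v)) r ≡ false
vertex-triple-sum {p} G v r = begin
  colSum (IAS G) triple r
    ≡⟨ sum-combine p 3 (λ l → triple l ∧ IAS G r l) ⟩
  sumGF2 {p} (λ u → sumGF2 {3} (λ t → triple (combine u t) ∧ IAS G r (combine u t)))
    ≡⟨ sum-cong (λ u → sum-cong (λ t → cong₂ _∧_ (cong (λ q → does (proj₁ q ≟ v)) (remQuot-combine {p} {3} u t)) (IAS-combine G r u t))) ⟩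
  sumGF2 {p} (λ u → sumGF2 {3} (λ t → does (u ≟ v) ∧ iasEntry (adj G) r u t))
    ≡⟨ sum-delta _ v (λ u ne → sum-zero _ (λ t → cong (_∧ iasEntry (adj G) r u t) (dec-false (u ≟ v) ne))) ⟩
  sumGF2 {3} (λ t → does (v ≟ v) ∧ iasEntry (adj G) r v t)
    ≡⟨ sum-cong (λ t → cong (_∧ iasEntry (adj G) r v t) (dec-true (v ≟ v) refl)) ⟩
  sumGF2 (iasEntry (adj G) r v)
    ≡⟨ triple-cancels (adj G) r v ⟩
  false ∎
  where
  open ≡-Reasoning
  triple : SubsetF (p * 3)
  triple l = does (vertexOf {p} l ≟ v)

-- The φ-elements form an independent set Φ with one element per class whose
-- (unit) columns span everything, so the rank is at most |Φ| = k.

module FromIsotropic {n k p : ℕ} (M : Matroid n) (cls : Fin n → Fin k) (G : LoopedSimpleGraph p)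
                     (π : Fin n ↔ Fin (p * 3)) (iso : IsoToIsotropic M cls G π) where

  open Inverse π using (to; from; strictlyInverseˡ; strictlyInverseʳ)
  open Relabel (IAS G) π
  open Represented M relabelled (λ S → ⇔.trans (proj₁ iso S) (relabel S))
  open Transversals cls

  vertex : Fin n → Fin p
  vertex e = proj₁ (remQuot {p} 3 (to e))

  position : Fin n → Fin 3
  position e = proj₂ (remQuot {p} 3 (to e))

  element : Fin p → Fin 3 → Fin n
  element v t = from (combine v t)

  vertex-position-element : ∀ v t → remQuot {p} 3 (to (element v t)) ≡ (v , t)
  vertex-position-element v t = trans (cong (remQuot 3) (strictlyInverseˡ (combine v t))) (remQuot-combine v t)

  label-injective : ∀ e e′ → vertex e ≡ vertex e′ → position e ≡ position e′ → e ≡ e′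
  label-injective e e′ v≡ t≡ = begin
    e                                ≡⟨ sym (strictlyInverseʳ e) ⟩
    from (to e)                      ≡⟨ cong from (sym (combine-remQuot {p} 3 (to e))) ⟩
    from (combine (vertex e) (position e))    ≡⟨ cong from (cong₂ combine v≡ t≡) ⟩
    from (combine (vertex e′) (position e′))  ≡⟨ cong from (combine-remQuot {p} 3 (to e′)) ⟩
    from (to e′)                     ≡⟨ strictlyInverseʳ e′ ⟩
    e′                               ∎
    where open ≡-Reasoning

  entry : ∀ r e → relabelled r e ≡ iasEntry (adj G) r (vertex e) (position e)
  entry r e = IAS-entry G r (to e)

  Φ : SubsetF n
  Φ e = does (position e ≟ zero)

  Φ-row : ∀ r e → Φ e ≡ true → relabelled r e ≡ does (e ≟ element r zero)
  Φ-row r e φe rewrite entry r e | does-true (position e ≟ zero) φe = bool-ext to-element from-element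
    where
    to-element : does (r ≟ vertex e) ≡ true → does (e ≟ element r zero) ≡ true
    to-element q = dec-true (e ≟ element r zero) (label-injective e (element r zero)
      (trans (sym (does-true (r ≟ vertex e) q)) (sym (cong proj₁ (vertex-position-element r zero))))
      (trans (does-true (position e ≟ zero) φe) (sym (cong proj₂ (vertex-position-element r zero)))))
    from-element : does (e ≟ element r zero) ≡ true → does (r ≟ vertex e) ≡ true
    from-element q with does-true (e ≟ element r zero) q
    ... | refl = dec-true (r ≟ vertex (element r zero)) (sym (cong proj₁ (vertex-position-element r zero)))

  Φ-element : ∀ e → Φ e ≡ true → element (vertex e) zero ≡ e
  Φ-element e φe = label-injective (element (vertex e) zero) e
    (cong proj₁ (vertex-position-element (vertex e) zero))
    (trans (cong proj₂ (vertex-position-element (vertex e) zero)) (sym (does-true (position e ≟ zero) φe)))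

  -- unit columns are independent
  Φ-independent : LinIndepCols relabelled Φ
  Φ-independent T T⊆Φ z i with bool-case (T i)
  ... | inj₂ ti = ti
  ... | inj₁ ti = ⊥-elim (true≢false (begin
    true                         ≡⟨ sym (BP.∧-identityʳ true) ⟩
    true ∧ true                  ≡⟨ cong₂ _∧_ (sym ti) (sym (trans (Φ-row (vertex i) i φi) (dec-true (i ≟ _) (sym (Φ-element i φi))))) ⟩
    T i ∧ relabelled (vertex i) i  ≡⟨ sym (colSum-isolated relabelled T i (vertex i) off-i) ⟩
    colSum relabelled T (vertex i) ≡⟨ z (vertex i) ⟩
    false                        ∎))
    where
    open ≡-Reasoning
    φi : Φ i ≡ true
    φi = T⊆Φ i ti
    off-i : ∀ e → T e ≡ true → ¬ e ≡ i → relabelled (vertex i) e ≡ false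
    off-i e te ne = trans (Φ-row (vertex i) e (T⊆Φ e te)) (dec-false (e ≟ _) (λ q → ne (trans q (Φ-element i φi))))

  -- every column is the sum of the φ-columns of the rows where it is nonzero
  Φ-spans : ∀ x → Spans relabelled Φ x
  Φ-spans x = C , (λ e q → BP.∧-conicalˡ (Φ e) _ q) , sums
    where
    C : SubsetF n
    C e = Φ e ∧ relabelled (vertex e) x
    φ : Fin p → Fin n
    φ r = element r zero
    φ-in-Φ : ∀ r → Φ (φ r) ≡ true
    φ-in-Φ r = dec-true (position (φ r) ≟ zero) (cong proj₂ (vertex-position-element r zero))
    sums : ∀ r → colSum relabelled C r ≡ relabelled r x
    sums r = begin
      colSum relabelled C r                               ≡⟨ colSum-isolated relabelled C (φ r) r off-φ ⟩
      (Φ (φ r) ∧ relabelled (vertex (φ r)) x) ∧ relabelled r (φ r)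
        ≡⟨ cong₂ (λ a b → (a ∧ relabelled b x) ∧ relabelled r (φ r)) (φ-in-Φ r) (cong proj₁ (vertex-position-element r zero)) ⟩
      relabelled r x ∧ relabelled r (φ r)                 ≡⟨ cong (relabelled r x ∧_) (trans (Φ-row r (φ r) (φ-in-Φ r)) (dec-true (φ r ≟ φ r) refl)) ⟩
      relabelled r x ∧ true                               ≡⟨ BP.∧-identityʳ _ ⟩
      relabelled r x                                      ∎
      where
      open ≡-Reasoning
      off-φ : ∀ e → C e ≡ true → ¬ e ≡ φ r → relabelled r e ≡ false
      off-φ e ce ne = trans (Φ-row r e (BP.∧-conicalˡ (Φ e) _ ce)) (dec-false (e ≟ φ r) ne)

  -- Φ is the transversal of the classes through the φ-elements
  Φ-card : ∣ Φ ∣F ≡ k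
  Φ-card = trans (card-cong Φ-transversal) (transversal-card φ-of φ-of-cls)
    where
    class-vertex : Fin k → Fin p
    class-vertex j = proj₁ (proj₂ iso j)
    in-class : ∀ j x → cls x ≡ j ⇔ vertexOf {p} (to x) ≡ class-vertex j
    in-class j = proj₂ (proj₂ iso j)
    φ-of : Fin k → Fin n
    φ-of j = element (class-vertex j) zero
    φ-of-cls : ∀ j → cls (φ-of j) ≡ j
    φ-of-cls j = Equivalence.from (in-class j (φ-of j)) (cong proj₁ (vertex-position-element (class-vertex j) zero))
    Φ-transversal : Φ ≐ Transversal φ-of
    Φ-transversal e = bool-ext
      (λ φe → dec-true (e ≟ φ-of (cls e)) (trans (sym (Φ-element e φe))
                 (cong (λ v → element v zero) (Equivalence.to (in-class (cls e) e) refl))))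
      (λ q → dec-true (position e ≟ zero) (trans (cong position (does-true (e ≟ φ-of (cls e)) q))
                 (cong proj₂ (vertex-position-element (class-vertex (cls e)) zero))))

  -- each class is a vertex triple, whose columns sum to zero
  class-zero-sum : ∀ j → ZeroSum (classOf cls j)
  class-zero-sum j r = begin
    colSum relabelled (classOf cls j) r                         ≡⟨ colSum-cong relabelled is-triple r ⟩
    colSum relabelled (λ e → triple (to e)) r                   ≡⟨ colSum-relabel triple r ⟩
    colSum (IAS G) triple r                                     ≡⟨ vertex-triple-sum G (proj₁ (proj₂ iso j)) r ⟩
    false                                                       ∎
    where
    open ≡-Reasoning
    triple : SubsetF (p * 3)
    triple l = does (vertexOf {p} l ≟ proj₁ (proj₂ iso j))
    is-triple : classOf cls j ≐ (λ e → triple (to e))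
    is-triple e = bool-ext
      (λ q → dec-true (vertexOf {p} (to e) ≟ _) (Equivalence.to (proj₂ (proj₂ iso j) e) (does-true (cls e ≟ j) q)))
      (λ q → dec-true (cls e ≟ j) (Equivalence.from (proj₂ (proj₂ iso j) e) (does-true (vertexOf {p} (to e) ≟ _) q)))

  strictly-binary-with-cycles : StrictlyBinary M k × (∀ j → InCycleSpace M (classOf cls j))
  strictly-binary-with-cycles =
    ((p , relabelled , λ S → ⇔.trans (proj₁ iso S) (relabel S)) ,
       subst (RankAtMost M) Φ-card (rank-bound Φ (fromLI Φ-independent) Φ-spans)) ,
    (λ j → zero-sum⇒cycle (classOf cls j) (class-zero-sum j))

record Labelling {n k} (cls : Fin n → Fin k) : Set where
  field
    element          : Fin k → Fin 3 → Fin n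
    position         : Fin n → Fin 3
    cls-element      : ∀ j t → cls (element j t) ≡ j
    position-element : ∀ j t → position (element j t) ≡ t
    element-position : ∀ z → element (cls z) (position z) ≡ z

  element-injective : ∀ j t t′ → element j t ≡ element j t′ → t ≡ t′
  element-injective j t t′ e = trans (sym (position-element j t)) (trans (cong position e) (position-element j t′))

  element-≟ : ∀ z j t → does (z ≟ element j t) ≡ does (cls z ≟ j) ∧ does (position z ≟ t)
  element-≟ z j t = bool-ext to from
    where
    to : does (z ≟ element j t) ≡ true → does (cls z ≟ j) ∧ does (position z ≟ t) ≡ true
    to q with does-true (z ≟ element j t) q
    ... | refl rewrite dec-true (cls (element j t) ≟ j) (cls-element j t)
                     | dec-true (position (element j t) ≟ t) (position-element j t) = refl
    from : does (cls z ≟ j) ∧ does (position z ≟ t) ≡ true → does (z ≟ element j t) ≡ true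
    from q = dec-true (z ≟ element j t) (trans (sym (element-position z))
      (cong₂ element (does-true (cls z ≟ j) (BP.∧-conicalˡ _ _ q)) (does-true (position z ≟ t) (BP.∧-conicalʳ _ _ q))))

  -- The labelling as a bijection onto the labels of IAS(G) for a graph on Fin k.
  bijection : Fin n ↔ Fin (k * 3)
  bijection = mk↔ₛ′ (λ z → combine (cls z) (position z)) (λ l → element (proj₁ (remQuot {k} 3 l)) (proj₂ (remQuot {k} 3 l)))
    (λ l → trans (cong₂ combine (cls-element _ _) (position-element _ _)) (combine-remQuot {k} 3 l))
    (λ z → trans (cong (λ q → element (proj₁ q) (proj₂ q)) (remQuot-combine {k} {3} (cls z) (position z))) (element-position z))

labelling : ∀ {n k} (cls : Fin n → Fin k) → AllClassesSize3 cls →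
  (start : Fin k → Fin n) → (∀ j → cls (start j) ≡ j) →
  Σ (Labelling cls) λ L → ∀ j → Labelling.element L j zero ≡ start j
labelling {n} {k} cls size3 start start-cls = L , λ j → proj₂ (E j)
  where
  E : ∀ j → Σ (Enumeration3 (classOf cls j)) λ En → Enumeration3.elem En zero ≡ start j
  E j = enumerate3 (classOf cls j) (start j) (size3 j) (dec-true (cls (start j) ≟ j) (start-cls j))
  module En j = Enumeration3 (proj₁ (E j))
  element : Fin k → Fin 3 → Fin n
  element j = En.elem j
  cls-element : ∀ j t → cls (element j t) ≡ j
  cls-element j t = does-true (cls (element j t) ≟ j) (En.elem-∈ j t)
  located : ∀ z → ∃ λ t → element (cls z) t ≡ z
  located z = En.elem-onto (cls z) z (dec-true (cls z ≟ cls z) refl)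
  position : Fin n → Fin 3
  position z = proj₁ (located z)
  element-position : ∀ z → element (cls z) (position z) ≡ z
  element-position z = proj₂ (located z)
  position-element : ∀ j t → position (element j t) ≡ t
  position-element j t = En.elem-injective j (position z) t
    (subst (λ i → element i (position z) ≡ z) (cls-element j t) (element-position z))
    where z = element j t
  L : Labelling cls
  L = record { element = element ; position = position ; cls-element = cls-element
             ; position-element = position-element ; element-position = element-position }

-- Given two distinct candidates a j, b j in each class, greedily extend a
-- partial transversal class by class; sheltering guarantees that one of
-- the two candidates of the next class can always be added.
module ShelteredTransversal {n k} (M : Matroid n) (cls : Fin n → Fin k) (sheltering : IsSheltering M cls)
  (a b : Fin k → Fin n) (a-cls : ∀ j → cls (a j) ≡ j) (b-cls : ∀ j → cls (b j) ≡ j) (a≢b : ∀ j → ¬ a j ≡ b j) where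

  open Transversals cls

  Partial : ℕ → (Fin k → Fin n) → SubsetF n
  Partial i sel z = does (toℕ (cls z) <? i) ∧ Transversal sel z

  Choice : ℕ → Set
  Choice i = Σ (Fin k → Fin n) λ sel → (∀ j → cls (sel j) ≡ j) × Indep M (Partial i sel)

  update : (Fin k → Fin n) → Fin k → Fin n → Fin k → Fin n
  update sel J₀ c j = if does (j ≟ J₀) then c else sel j

  step : ∀ i → (i<k : i < k) → Choice i → Choice (suc i)
  step i i<k (sel , sel-cls , indep) = choose (sheltering I indep (meets-once sel I (λ z q → BP.∧-conicalʳ _ _ q))
    J₀ (a J₀) (b J₀) (a-cls J₀) (b-cls J₀) (a≢b J₀) untouched)
    where
    I = Partial i sel
    J₀ : Fin k
    J₀ = fromℕ< i<k
    untouched : ∀ z → cls z ≡ J₀ → I z ≡ false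
    untouched z e rewrite dec-false (toℕ (cls z) <? i) (λ lt → ℕP.<-irrefl (trans (cong toℕ e) (toℕ-fromℕ< i<k)) lt) = refl
    updated-cls : ∀ c → cls c ≡ J₀ → ∀ j → cls (update sel J₀ c j) ≡ j
    updated-cls c c-cls j with j ≟ J₀
    ... | yes refl = c-cls
    ... | no _ = sel-cls j
    grown : ∀ c → Partial (suc i) (update sel J₀ c) ⊆F (I ∪F ⁅ c ⁆F)
    grown c z q with cls z ≟ J₀
    ... | yes _ = trans (cong (I z ∨_) (BP.∧-conicalʳ _ _ q)) (BP.∨-zeroʳ (I z))
    ... | no ne = cong (_∨ ⁅ c ⁆F z) earlier
      where
      below : toℕ (cls z) < i
      below = ℕP.≤∧≢⇒< (ℕP.≤-pred (does-true (toℕ (cls z) <? suc i) (BP.∧-conicalˡ _ _ q)))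
                         (λ eq → ne (toℕ-injective (trans eq (sym (toℕ-fromℕ< i<k)))))
      earlier : I z ≡ true
      earlier = cong₂ _∧_ (dec-true (toℕ (cls z) <? i) below) (BP.∧-conicalʳ _ _ q)
    choose : Indep M (I ∪F ⁅ a J₀ ⁆F) ⊎ Indep M (I ∪F ⁅ b J₀ ⁆F) → Choice (suc i)
    choose (inj₁ ind) = update sel J₀ (a J₀) , updated-cls (a J₀) (a-cls J₀) , indep-⊆ M _ _ (grown (a J₀)) ind
    choose (inj₂ ind) = update sel J₀ (b J₀) , updated-cls (b J₀) (b-cls J₀) , indep-⊆ M _ _ (grown (b J₀)) ind

  build : ∀ i → i ≤ k → Choice i
  build zero _ = a , a-cls , indep-⊆ M _ ∅F (λ z ()) (indep-∅ M)
  build (suc i) i<k = step i i<k (build i (ℕP.≤-trans (ℕP.n≤1+n i) i<k))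

  independent-transversal : Σ (Fin k → Fin n) λ sel → (∀ j → cls (sel j) ≡ j) × Indep M (Transversal sel)
  independent-transversal with build k ℕP.≤-refl
  ... | sel , sel-cls , indep = sel , sel-cls , indep-⊆ M _ _ all-classes indep
    where
    all-classes : Transversal sel ⊆F Partial k sel
    all-classes z q = cong₂ _∧_ (dec-true (toℕ (cls z) <? k) (toℕ<n (cls z))) q

module ToIsotropic {m n k} (M : Matroid n) (cls : Fin n → Fin k) (sheltering : IsSheltering M cls)
  (A : Matrix m n) (rep : RepresentedBy M A) (rank : RankAtMost M k)
  (cycles : ∀ j → InCycleSpace M (classOf cls j)) (L : Labelling cls)
  (basis-indep : Indep M (λ z → does (Labelling.position L z ≟ zero))) where

  open Labelling L
  open Represented M A rep
  open Transversals cls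

  Sel : (Fin k → Fin 3) → SubsetF n
  Sel t z = does (position z ≟ t (cls z))

  Sel-transversal : ∀ t → Sel t ≐ Transversal (λ j → element j (t j))
  Sel-transversal t z = sym (trans (element-≟ z (cls z) (t (cls z))) (cong (_∧ Sel t z) (dec-true (cls z ≟ cls z) refl)))

  Sel-card : ∀ t → ∣ Sel t ∣F ≡ k
  Sel-card t = trans (card-cong (Sel-transversal t)) (transversal-card _ (λ j → cls-element j (t j)))

  B : SubsetF n
  B = Sel (λ _ → zero)

  φ χ ψ : Fin k → Fin n
  φ j = element j zero
  χ j = element j (suc zero)
  ψ j = element j (suc (suc zero))

  B-φ : ∀ u → B u ≡ true → φ (cls u) ≡ u
  B-φ u q = trans (cong (element (cls u)) (sym (does-true (position u ≟ zero) q))) (element-position u)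

  -- B ∪ {χ v} has k + 1 elements, more than the rank, so χ v is spanned by B.
  χ-spanned : ∀ v → Spans A B (χ v)
  χ-spanned v = dependent⇒span A B (χ v) (toLI basis-indep) too-large
    where
    χ∉B : B (χ v) ≡ false
    χ∉B = dec-false (position (χ v) ≟ zero) (λ q → 1≢0 (trans (sym (position-element v (suc zero))) q))
      where
      1≢0 : ¬ _≡_ {A = Fin 3} (suc zero) zero
      1≢0 ()
    too-large : ¬ LinIndepCols A (B ∪F ⁅ χ v ⁆F)
    too-large li = ℕP.<-irrefl refl (subst (_≤ k) (trans (card-insert B (χ v) χ∉B) (cong suc (Sel-card _))) (rank _ (fromLI li)))

  coefficients : Fin k → SubsetF n
  coefficients v = proj₁ (χ-spanned v)

  coefficients-⊆ : ∀ v → coefficients v ⊆F B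
  coefficients-⊆ v = proj₁ (proj₂ (χ-spanned v))

  coefficients-sum : ∀ v r → colSum A (coefficients v) r ≡ A r (χ v)
  coefficients-sum v = proj₂ (proj₂ (χ-spanned v))

  adjacency : Fin k → Fin k → Bool
  adjacency w v = coefficients v (φ w)

  N : Matrix k n
  N w e = iasEntry adjacency w (cls e) (position e)

  N-entry : ∀ w v t → N w (element v t) ≡ iasEntry adjacency w v t
  N-entry w v t rewrite cls-element v t | position-element v t = refl

  class-split : ∀ v → classOf cls v ≐ (λ z → ⁅ φ v ⁆F z xor (⁅ χ v ⁆F z xor ⁅ ψ v ⁆F z))
  class-split v z rewrite element-≟ z v zero | element-≟ z v (suc zero) | element-≟ z v (suc (suc zero))
    with cls z ≟ v
  ... | no _ = refl
  ... | yes _ with position z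
  ...   | zero = refl
  ...   | suc zero = refl
  ...   | suc (suc zero) = refl

  -- ψ v = φ v + χ v, because the class of v is a cycle
  ψ-column : ∀ v r → A r (ψ v) ≡ A r (φ v) xor A r (χ v)
  ψ-column v r = xor-zero⇒≡ (A r (φ v) xor A r (χ v)) (A r (ψ v)) (begin
    (A r (φ v) xor A r (χ v)) xor A r (ψ v)          ≡⟨ BP.xor-assoc (A r (φ v)) _ _ ⟩
    A r (φ v) xor (A r (χ v) xor A r (ψ v))          ≡⟨ sym (cong₂ _xor_ (colSum-single A (φ v) r) (trans (colSum-xor A _ _ r)
                                                          (cong₂ _xor_ (colSum-single A (χ v) r) (colSum-single A (ψ v) r)))) ⟩
    colSum A ⁅ φ v ⁆F r xor colSum A (λ z → ⁅ χ v ⁆F z xor ⁅ ψ v ⁆F z) r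
                                                     ≡⟨ sym (colSum-xor A ⁅ φ v ⁆F _ r) ⟩
    colSum A (λ z → ⁅ φ v ⁆F z xor (⁅ χ v ⁆F z xor ⁅ ψ v ⁆F z)) r
                                                     ≡⟨ sym (colSum-cong A (class-split v) r) ⟩
    colSum A (classOf cls v) r                       ≡⟨ cycle-sum (classOf cls v) (cycles v) r ⟩
    false                                            ∎)
    where open ≡-Reasoning

  basis-row : ∀ v → (λ u → B u ∧ does (cls u ≟ v)) ≐ ⁅ φ v ⁆F
  basis-row v u = trans (BP.∧-comm (B u) _) (sym (element-≟ u v zero))

  basis-coefficients : ∀ v → (λ u → B u ∧ adjacency (cls u) v) ≐ coefficients v
  basis-coefficients v u with bool-case (B u)
  ... | inj₁ bu rewrite bu = cong (coefficients v) (B-φ u bu)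
  ... | inj₂ bu rewrite bu with bool-case (coefficients v u)
  ...   | inj₁ cu = ⊥-elim (true≢false (trans (sym (coefficients-⊆ v u cu)) bu))
  ...   | inj₂ cu = sym cu

  expansion : ∀ v t r → colSum A (λ u → B u ∧ iasEntry adjacency (cls u) v t) r ≡ A r (element v t)
  expansion v zero r = trans (colSum-cong A (basis-row v) r) (colSum-single A (φ v) r)
  expansion v (suc zero) r = trans (colSum-cong A (basis-coefficients v) r) (coefficients-sum v r)
  expansion v (suc (suc zero)) r = begin
    colSum A (λ u → B u ∧ (adjacency (cls u) v xor does (cls u ≟ v))) r
      ≡⟨ colSum-cong A (λ u → trans (BP.∧-distribˡ-xor (B u) _ _) (cong₂ _xor_ (basis-coefficients v u) (basis-row v u))) r ⟩
    colSum A (λ u → C u xor ⁅ φ v ⁆F u) r        ≡⟨ colSum-xor A C ⁅ φ v ⁆F r ⟩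
    colSum A C r xor colSum A ⁅ φ v ⁆F r          ≡⟨ cong₂ _xor_ (proj₂ (proj₂ (χ-spanned v)) r) (colSum-single A (φ v) r) ⟩
    A r (χ v) xor A r (φ v)                       ≡⟨ BP.xor-comm (A r (χ v)) _ ⟩
    A r (φ v) xor A r (χ v)                       ≡⟨ sym (ψ-column v r) ⟩
    A r (ψ v)                                     ∎
    where
    open ≡-Reasoning
    C = coefficients v

  basis-expansion : ∀ e r → colSum A (λ u → B u ∧ N (cls u) e) r ≡ A r e
  basis-expansion e r = trans (expansion (cls e) (position e) r) (cong (A r) (element-position e))

  ∧-rearrange : ∀ a b c d → a ∧ ((b ∧ c) ∧ d) ≡ (b ∧ (a ∧ c)) ∧ d
  ∧-rearrange false false c d = refl
  ∧-rearrange false true c d = refl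
  ∧-rearrange true false c d = refl
  ∧-rearrange true true c d = refl

  factorisation : ∀ T r → colSum A T r ≡ colSum A (λ u → B u ∧ colSum N T (cls u)) r
  factorisation T r = begin
    sumGF2 (λ e → T e ∧ A r e)
      ≡⟨ sum-cong (λ e → cong (T e ∧_) (sym (basis-expansion e r))) ⟩
    sumGF2 (λ e → T e ∧ sumGF2 (λ u → (B u ∧ N (cls u) e) ∧ A r u))
      ≡⟨ sum-cong (λ e → sum-∧ˡ (T e) (λ u → (B u ∧ N (cls u) e) ∧ A r u)) ⟩
    sumGF2 (λ e → sumGF2 (λ u → T e ∧ ((B u ∧ N (cls u) e) ∧ A r u)))
      ≡⟨ sum-swap (λ e u → T e ∧ ((B u ∧ N (cls u) e) ∧ A r u)) ⟩
    sumGF2 (λ u → sumGF2 (λ e → T e ∧ ((B u ∧ N (cls u) e) ∧ A r u)))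
      ≡⟨ sum-cong (λ u → sum-cong (λ e → ∧-rearrange (T e) (B u) _ _)) ⟩
    sumGF2 (λ u → sumGF2 (λ e → (B u ∧ (T e ∧ N (cls u) e)) ∧ A r u))
      ≡⟨ sum-cong (λ u → sym (sum-∧ʳ (λ e → B u ∧ (T e ∧ N (cls u) e)) (A r u))) ⟩
    sumGF2 (λ u → sumGF2 (λ e → B u ∧ (T e ∧ N (cls u) e)) ∧ A r u)
      ≡⟨ sum-cong (λ u → cong (_∧ A r u) (sym (sum-∧ˡ (B u) (λ e → T e ∧ N (cls u) e)))) ⟩
    sumGF2 (λ u → (B u ∧ colSum N T (cls u)) ∧ A r u) ∎
    where open ≡-Reasoning

  φ∈B : ∀ w → B (φ w) ≡ true
  φ∈B w = dec-true (position (φ w) ≟ zero) (position-element w zero)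

  -- A zero-sum set for A is zero-sum for N: by the factorisation its
  -- coordinates form a zero-sum subset of the independent set B.
  coordinates-vanish : ∀ T → ZeroSum T → ∀ w → colSum N T w ≡ false
  coordinates-vanish T zA w = begin
    colSum N T w                          ≡⟨ cong (colSum N T) (sym (cls-element w zero)) ⟩
    colSum N T (cls (φ w))                ≡⟨ cong (_∧ colSum N T (cls (φ w))) (sym (φ∈B w)) ⟩
    B (φ w) ∧ colSum N T (cls (φ w))      ≡⟨ toLI basis-indep coordinates (λ u q → BP.∧-conicalˡ _ _ q)
                                               (λ r → trans (sym (factorisation T r)) (zA r)) (φ w) ⟩
    false                                 ∎
    where
    open ≡-Reasoning
    coordinates : SubsetF n
    coordinates u = B u ∧ colSum N T (cls u)

  N-represents : RepresentedBy M N
  N-represents S = mk⇔ to-N from-N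
    where
    to-N : Indep M S → LinIndepCols N S
    to-N ind T T⊆S zN = toLI ind T T⊆S λ r → trans (factorisation T r)
      (colSum-∅ A _ (λ u → trans (cong (B u ∧_) (zN (cls u))) (BP.∧-zeroʳ (B u))) r)
    from-N : LinIndepCols N S → Indep M S
    from-N li = fromLI λ T T⊆S zA → li T T⊆S (coordinates-vanish T zA)

  toN : ∀ {S} → Indep M S → LinIndepCols N S
  toN {S} = Equivalence.to (N-represents S)

  fromN : ∀ {S} → LinIndepCols N S → Indep M S
  fromN {S} = Equivalence.from (N-represents S)

  row-on-basis : ∀ r e → B e ≡ true → ¬ cls e ≡ r → N r e ≡ false
  row-on-basis r e be ne =
    trans (cong (N r) (sym (B-φ e be))) (trans (N-entry r (cls e) zero) (dec-false (r ≟ cls e) (λ q → ne (sym q))))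

  -- Sheltering forces the adjacency to be symmetric.  Suppose φ w occurs in
  -- χ v but φ v does not occur in χ w.  Let h be the element of v's triple
  -- that row v does not see.  Adding h to the φ-elements outside the classes
  -- of v and w gives an independent set I (row w detects h); sheltering adds
  -- an element x of w's triple; and row v then detects φ v on I ∪ {x}, so
  -- Y = I ∪ {x} ∪ {φ v} would be independent with k + 1 elements.
  module Asymmetry (v w : Fin k) (v≢w : ¬ v ≡ w) (wv : adjacency w v ≡ true) (vw : adjacency v w ≡ false) where

    hpos : Fin 3
    hpos = if adjacency v v then suc (suc zero) else suc zero

    h : Fin n
    h = element v hpos

    hpos-row-v : iasEntry adjacency v v hpos ≡ false
    hpos-row-v with adjacency v v in e
    ... | true rewrite e | dec-true (v ≟ v) refl = refl
    ... | false rewrite e = refl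

    hpos-row-w : iasEntry adjacency w v hpos ≡ true
    hpos-row-w with adjacency v v
    ... | true rewrite wv | dec-false (w ≟ v) (λ q → v≢w (sym q)) = refl
    ... | false = wv

    hpos≢0 : ¬ hpos ≡ zero
    hpos≢0 with adjacency v v
    ... | true = λ ()
    ... | false = λ ()

    row-v-on-w : ∀ t → iasEntry adjacency v w t ≡ false
    row-v-on-w zero = dec-false (v ≟ w) v≢w
    row-v-on-w (suc zero) = vw
    row-v-on-w (suc (suc zero)) rewrite vw | dec-false (v ≟ w) v≢w = refl

    others : SubsetF n
    others e = B e ∧ not (does (cls e ≟ v) ∨ does (cls e ≟ w))

    others-member : ∀ e → others e ≡ true → B e ≡ true × ¬ cls e ≡ v × ¬ cls e ≡ w
    others-member e q with B e | cls e ≟ v | cls e ≟ w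
    ... | true | no nv | no nw = refl , nv , nw

    I : SubsetF n
    I = others ∪F ⁅ h ⁆F

    I-indep : LinIndepCols N I
    I-indep = extend-indep N others (LinIndep-⊆ N (λ e q → proj₁ (others-member e q)) (toN basis-indep))
      h w (trans (N-entry w v hpos) hpos-row-w)
      (λ e q → let (be , _ , nw) = others-member e q in row-on-basis w e be nw)

    positions : Fin 3 → Fin k → Fin 3
    positions t′ j = if does (j ≟ v) then hpos else (if does (j ≟ w) then t′ else zero)

    exclusive : ∀ e → does (cls e ≟ v) ∧ does (cls e ≟ w) ≡ false
    exclusive e with cls e ≟ v
    ... | no _ = refl
    ... | yes cv = dec-false (cls e ≟ w) (λ cw → v≢w (trans (sym cv) cw))

    extended : ∀ t′ → (I ∪F ⁅ element w t′ ⁆F) ≐ Sel (positions t′)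
    extended t′ e =
      trans (cong₂ (λ a b → (others e ∨ a) ∨ b) (element-≟ e v hpos) (element-≟ e w t′))
            (select (λ t → does (position e ≟ t)) (does (cls e ≟ v)) (does (cls e ≟ w)) (exclusive e))
      where
      select : ∀ (p : Fin 3 → Bool) dv dw → dv ∧ dw ≡ false →
        (p zero ∧ not (dv ∨ dw) ∨ dv ∧ p hpos) ∨ dw ∧ p t′ ≡ p (if dv then hpos else (if dw then t′ else zero))
      select p true false _ rewrite BP.∧-zeroʳ (p zero) = BP.∨-identityʳ (p hpos)
      select p false true _ rewrite BP.∧-zeroʳ (p zero) = refl
      select p false false _ rewrite BP.∧-identityʳ (p zero) | BP.∨-identityʳ (p zero) = BP.∨-identityʳ (p zero)

    positions-v : ∀ t′ → positions t′ v ≡ hpos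
    positions-v t′ rewrite dec-true (v ≟ v) refl = refl

    row-v-vanishes : ∀ t′ e → Sel (positions t′) e ≡ true → N v e ≡ false
    row-v-vanishes t′ e q with cls e ≟ v
    ... | yes cv = trans (cong₂ (iasEntry adjacency v) cv (does-true (position e ≟ hpos) q)) hpos-row-v
    ... | no nv with cls e ≟ w
    ...   | yes cw = trans (cong (λ j → iasEntry adjacency v j (position e)) cw) (row-v-on-w (position e))
    ...   | no nw = trans (cong (iasEntry adjacency v (cls e)) pe) (dec-false (v ≟ cls e) (λ q′ → nv (sym q′)))
      where
      pe : position e ≡ zero
      pe = does-true (position e ≟ zero) q

    -- Y = I ∪ {x} ∪ {φ v} would be an independent set of size k + 1
    too-large : ∀ t′ → Indep M (I ∪F ⁅ element w t′ ⁆F) → ⊥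
    too-large t′ ind = ℕP.<-irrefl refl (subst (_≤ k) card (rank Y (fromN Y-indep)))
      where
      X Y : SubsetF n
      X = I ∪F ⁅ element w t′ ⁆F
      Y = X ∪F ⁅ φ v ⁆F
      φv∉X : X (φ v) ≡ false
      φv∉X = trans (extended t′ (φ v)) (dec-false (position (φ v) ≟ _) λ q → hpos≢0 (sym (begin
        zero                           ≡⟨ sym (position-element v zero) ⟩
        position (φ v)                 ≡⟨ q ⟩
        positions t′ (cls (φ v))       ≡⟨ cong (positions t′) (cls-element v zero) ⟩
        positions t′ v                 ≡⟨ positions-v t′ ⟩
        hpos                           ∎)))
        where open ≡-Reasoning
      card : ∣ Y ∣F ≡ suc k
      card = trans (card-insert X (φ v) φv∉X) (cong suc (trans (card-cong (extended t′)) (Sel-card (positions t′))))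
      Y-indep : LinIndepCols N Y
      Y-indep = extend-indep N X (toN ind) (φ v) v (trans (N-entry v v zero) (dec-true (v ≟ v) refl))
        (λ e q → row-v-vanishes t′ e (trans (sym (extended t′ e)) q))

    absurd : ⊥
    absurd with sheltering I (fromN I-indep) meets w (χ w) (ψ w) (cls-element w _) (cls-element w _)
                (λ e → 1≢2 (element-injective w _ _ e)) untouched
      where
      1≢2 : ¬ _≡_ {A = Fin 3} (suc zero) (suc (suc zero))
      1≢2 ()
      meets : ∀ j → ∣ I ∩F classOf cls j ∣F ≤ 1
      meets = meets-once (λ j → element j (positions zero j)) I
        (λ e q → trans (sym (Sel-transversal (positions zero) e)) (trans (sym (extended zero e)) (cong (_∨ ⁅ element w zero ⁆F e) q)))
      untouched : ∀ e → cls e ≡ w → I e ≡ false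
      untouched e ce = cong₂ _∨_
        (trans (cong (λ b → B e ∧ not (does (cls e ≟ v) ∨ b)) (dec-true (cls e ≟ w) ce))
               (trans (cong (λ b → B e ∧ not b) (BP.∨-zeroʳ _)) (BP.∧-zeroʳ (B e))))
        (trans (element-≟ e v hpos) (cong (_∧ does (position e ≟ hpos)) (dec-false (cls e ≟ v) (λ cv → v≢w (trans (sym cv) ce)))))
    ... | inj₁ ind = too-large (suc zero) ind
    ... | inj₂ ind = too-large (suc (suc zero)) ind

  adjacency-symmetric : ∀ w v → adjacency w v ≡ adjacency v w
  adjacency-symmetric w v with w ≟ v
  ... | yes refl = refl
  ... | no w≢v with bool-case (adjacency w v) | bool-case (adjacency v w)
  ...   | inj₁ a | inj₁ b = trans a (sym b)
  ...   | inj₂ a | inj₂ b = trans a (sym b)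
  ...   | inj₁ a | inj₂ b = ⊥-elim (Asymmetry.absurd v w (λ q → w≢v (sym q)) a b)
  ...   | inj₂ a | inj₁ b = ⊥-elim (Asymmetry.absurd w v w≢v b a)

  graph : LoopedSimpleGraph k
  graph = record { adj = adjacency ; adj-sym = adjacency-symmetric }

  open Relabel (IAS graph) bijection

  relabelled≡N : ∀ r e → N r e ≡ relabelled r e
  relabelled≡N r e = sym (IAS-combine graph r (cls e) (position e))

  isotropic : IsoToIsotropic M cls graph bijection
  isotropic = (λ S → ⇔.trans (N-represents S) (⇔.trans (LinIndep-pointwise N relabelled relabelled≡N S) (⇔.sym (relabel S)))) ,
              (λ j → j , λ x → mk⇔ (λ e → trans (vertex-cls x) e) (λ e → trans (sym (vertex-cls x)) e))
    where
    vertex-cls : ∀ x → vertexOf {k} (Inverse.to bijection x) ≡ cls x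
    vertex-cls x = cong proj₁ (remQuot-combine {k} {3} (cls x) (position x))

-- Every 3-sheltering matroid has a labelling whose φ-elements are
-- independent: label arbitrarily, use sheltering to find an independent
-- transversal among positions 0 and 1, and relabel each class from it.
opaque
 independent-labelling : ∀ {n k} (M : Matroid n) (cls : Fin n → Fin k) → Is3Sheltering M cls →
   Σ (Labelling cls) λ L → Indep M (λ z → does (Labelling.position L z ≟ zero))
 independent-labelling {n} {k} M cls (size3 , sheltering) = L , indep-⊆ M _ _ φ⊆transversal indep
   where
   open Transversals cls
   some : ∀ j → ∃ λ x → classOf cls j x ≡ true
   some j = nonempty (classOf cls j) (size3 j)
   L₀ : Labelling cls
   L₀ = proj₁ (labelling cls size3 (λ j → proj₁ (some j)) (λ j → does-true (_ ≟ j) (proj₂ (some j))))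
   module L₀ = Labelling L₀
   0≢1 : ¬ _≡_ {A = Fin 3} zero (suc zero)
   0≢1 ()
   transversal : Σ (Fin k → Fin n) λ sel → (∀ j → cls (sel j) ≡ j) × Indep M (Transversal sel)
   transversal = ShelteredTransversal.independent-transversal M cls sheltering
     (λ j → L₀.element j zero) (λ j → L₀.element j (suc zero))
     (λ j → L₀.cls-element j zero) (λ j → L₀.cls-element j (suc zero))
     (λ j e → 0≢1 (L₀.element-injective j zero (suc zero) e))
   sel : Fin k → Fin n
   sel = proj₁ transversal
   indep : Indep M (Transversal sel)
   indep = proj₂ (proj₂ transversal)
   relabelled-from-sel : Σ (Labelling cls) λ L → ∀ j → Labelling.element L j zero ≡ sel j
   relabelled-from-sel = labelling cls size3 sel (proj₁ (proj₂ transversal))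
   L : Labelling cls
   L = proj₁ relabelled-from-sel
   open Labelling L
   φ⊆transversal : (λ z → does (position z ≟ zero)) ⊆F Transversal sel
   φ⊆transversal z q = begin
     does (z ≟ sel (cls z))                         ≡⟨ cong (λ y → does (z ≟ y)) (sym (proj₂ relabelled-from-sel (cls z))) ⟩
     does (z ≟ element (cls z) zero)                ≡⟨ element-≟ z (cls z) zero ⟩
     does (cls z ≟ cls z) ∧ does (position z ≟ zero) ≡⟨ cong₂ _∧_ (dec-true (cls z ≟ cls z) refl) q ⟩
     true                                           ∎
     where open ≡-Reasoning

theorem22 : ∀ {n k : ℕ} (M : Matroid n) (cls : Fin n → Fin k) →
    Is3Sheltering M cls →
    (StrictlyBinary M k × (∀ j → InCycleSpace M (classOf cls j)))
      ⇔ (Σ ℕ λ p → Σ (LoopedSimpleGraph p) λ G → Σ (Fin n ↔ Fin (p * 3)) λ f →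
           IsoToIsotropic M cls G f)
theorem22 {n} {k} M cls shelter3 = mk⇔ to-isotropic from-isotropic
  where
  to-isotropic : StrictlyBinary M k × (∀ j → InCycleSpace M (classOf cls j)) →
    Σ ℕ λ p → Σ (LoopedSimpleGraph p) λ G → Σ (Fin n ↔ Fin (p * 3)) λ f → IsoToIsotropic M cls G f
  to-isotropic (((m , A , rep) , rank) , cycles) = k , graph , Labelling.bijection L , isotropic
    where
    L = proj₁ (independent-labelling M cls shelter3)
    open ToIsotropic M cls (proj₂ shelter3) A rep rank cycles L (proj₂ (independent-labelling M cls shelter3))
  from-isotropic : (Σ ℕ λ p → Σ (LoopedSimpleGraph p) λ G → Σ (Fin n ↔ Fin (p * 3)) λ f → IsoToIsotropic M cls G f) →
    StrictlyBinary M k × (∀ j → InCycleSpace M (classOf cls j))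
  from-isotropic (p , G , f , iso) = FromIsotropic.strictly-binary-with-cycles M cls G f iso
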